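{- Let $w\ge 3$ and $n$ be positive integers with $n\equiv 1\pmod{w-1}$ and $n(n-1)-n(w-1)(w-2)\equiv(2k+1)(w-1)\pmod{w(w-1)}$ for some integer $k\in[0,\frac{w-3}{2}]$. If $\mathcal C$ is a balanced $(n,2w-2,w)_3$ code of size $B(n)+n$, where $B(n)=\left\lfloor\frac{n(n-1-(w-1)(w-2))}{w(w-1)}\right\rfloor$, then $\mathcal C$ contains a codeword that is neither of type $1^w$ nor of type $1^{w-2}2^1$.
   Context: For $\bm u,\bm v\in\{0,1,2\}^n$, the $\ell_1$-distance is $\sum_i|u_i-v_i|$ and the $\ell_1$-weight of $\bm u$ is its distance to $\bm 0$; $supp(\bm u)=\{i:u_i\ne0\}$. An $(n,d,w)_3$ code is a set of vectors in $\{0,1,2\}^n$ each of $\ell_1$-weight $w$, with pairwise $\ell_1$-distances at least $d$. A codeword has type $1^a2^b$ if exactly $a$ entries equal $1$ and exactly $b$ entries equal $2$. A code is balanced if the supports of its codewords, viewed as cliques in $K_n$ on $[n]$, form a decomposition of $K_n$. -}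

module Defs where

open import Data.Nat using (ℕ; zero; suc; _+_; _*_; _∸_; _≤_; ∣_-_∣)
open import Data.Fin using (Fin; toℕ)
import Data.Fin as F
open import Data.Vec using (Vec; []; _∷_; lookup)
open import Data.List using (List; []; _∷_; length)
open import Data.List.Relation.Unary.AllPairs using (AllPairs)
open import Data.Bool using (Bool; true; false; _∧_; not; if_then_else_)
open import Data.Integer using (ℤ; +_; _-_; _/ℕ_)
import Data.Integer as ℤ
open import Data.List.Membership.Propositional using (_∈_)
open import Data.Product using (_×_)
open import Relation.Nullary using (yes; no)
open import Data.Empty using (⊥)
open import Relation.Binary.PropositionalEquality using (_≡_)

Word : ℕ → Set
Word n = Vec (Fin 3) n

dist : ∀ {n} → Word n → Word n → ℕ
dist [] [] = 0
dist (a ∷ u) (b ∷ v) = ∣ toℕ a - toℕ b ∣ + dist u v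

weight : ∀ {n} → Word n → ℕ
weight [] = 0
weight (a ∷ u) = toℕ a + weight u

countSym : ∀ {n} → Fin 3 → Word n → ℕ
countSym s [] = 0
countSym s (a ∷ u) with toℕ a Data.Nat.≟ toℕ s
... | yes _ = suc (countSym s u)
... | no _ = countSym s u

HasType : ∀ {n} → Word n → ℕ → ℕ → Set
HasType u a b = (countSym (F.suc F.zero) u ≡ a) × (countSym (F.suc (F.suc F.zero)) u ≡ b)

-- an (n,d,w)_3 code, given as a list of codewords: every codeword has weight w
-- and any two codewords (at distinct positions of the list) have distance ≥ d
-- (for d ≥ 1 this forces the listed codewords to be distinct, so size = length)
record IsCode (n d w : ℕ) (C : List (Word n)) : Set where
  field
    weights : ∀ c → c ∈ C → weight c ≡ w
    distances : AllPairs (λ u v → d ≤ dist u v) C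

inSupp : ∀ {n} → Word n → Fin n → Bool
inSupp u i with toℕ (lookup u i)
... | zero = false
... | suc _ = true

coverCount : ∀ {n} → List (Word n) → Fin n → Fin n → ℕ
coverCount [] i j = 0
coverCount (c ∷ C) i j =
  (if inSupp c i ∧ inSupp c j then 1 else 0) + coverCount C i j

-- balanced: the supports (as cliques of K_n) decompose K_n, i.e. every edge
-- {i,j} (i ≠ j) lies in exactly one support
Balanced : ∀ {n} → List (Word n) → Set
Balanced {n} C = ∀ (i j : Fin n) → (i ≡ j → ⊥) → coverCount C i j ≡ 1

-- B(n) = ⌊ n (n - 1 - (w-1)(w-2)) / (w (w-1)) ⌋  (integer floor; only used for w ≥ 2)
B : ℕ → ℕ → ℤ
B zero n = + 0
B (suc zero) n = + 0
B w@(suc (suc m)) n =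
  ((+ n) ℤ.* ((+ n) - + 1 - + ((w ∸ 1) * (w ∸ 2)))) /ℕ (w * (w ∸ 1))

module Submission where

-- If every codeword had type 1^w or 1^(w-2)2, every support would have w or w − 1
-- points. As the supports decompose K_n, counting ordered pairs of distinct points
-- gives Σ_c |supp c| (|supp c| − 1) = n (n − 1), that is
-- n (n − 1) + 2 (w − 1) b = w (w − 1) |C| with b the number of codewords of the second
-- type. Together with |C| = B(n) + n this makes the remainder of n (n − 1 − (w−1)(w−2))
-- modulo w (w − 1) equal to 2 (w − 1) (n − b), whereas the congruence hypothesis makes
-- it (2k + 1)(w − 1); hence 2 (n − b) = 2k + 1, which is absurd.

open import Defs

module Supports where
  open import Data.Bool using (Bool; true; false; _∧_; if_then_else_)
  open import Data.Bool.Properties using (∧-idem)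
  open import Data.Empty using (⊥-elim)
  open import Data.Fin using (Fin; suc; punchIn; toℕ)
  open import Data.Fin.Patterns using (0F; 1F; 2F)
  open import Data.Fin.Properties using (punchInᵢ≢i)
  open import Data.List using (List; []; _∷_; length; map)
  open import Data.List.Relation.Unary.All using (All; []; _∷_)
  open import Data.Nat using (ℕ; zero; suc; _+_; _*_; _∸_; _≟_)
  open import Data.Nat.ListAction using (sum)
  open import Data.Nat.Properties
    using (+-*-semiring; +-identityʳ; *-identityʳ; *-zeroʳ; +-suc; +-comm; +-assoc; +-cancelˡ-≡)
  open import Algebra.Properties.Semiring.Sum +-*-semiring
    using (sum-syntax; sum-cong-≗; ∑-distrib-+; *-distribˡ-sum; *-distribʳ-sum; sum-remove)
  open import Data.Nat.Tactic.RingSolver using (solve-∀)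
  open import Data.Product using (∃; _×_; _,_)
  open import Data.Sum using (_⊎_; inj₁; inj₂)
  open import Data.Vec using ([]; _∷_; lookup)
  open import Relation.Nullary using (¬_; Dec; yes; no; _×-dec_)
  open import Relation.Binary.PropositionalEquality
  open ≡-Reasoning

  -- Written with if_then_else_ so that coverCount unfolds to it.
  indicator : Bool → ℕ
  indicator b = if b then 1 else 0

  indicator-∧ : ∀ a b → indicator (a ∧ b) ≡ indicator a * indicator b
  indicator-∧ true b = sym (+-identityʳ (indicator b))
  indicator-∧ false b = refl

  ∣supp∣ : ∀ {n} → Word n → ℕ
  ∣supp∣ {n} u = ∑[ i < n ] indicator (inSupp u i)

  ∑-const : ∀ n m → ∑[ i < n ] m ≡ n * m
  ∑-const zero m = refl
  ∑-const (suc n) m = cong (m +_) (∑-const n m)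

  ∑-zeros : ∀ n → ∑[ i < n ] 0 ≡ 0
  ∑-zeros n = trans (∑-const n 0) (*-zeroʳ n)

  ∑-ones-except : ∀ {n} (f : Fin (suc n) → ℕ) i →
    (∀ j → i ≢ j → f j ≡ 1) → ∑[ j < suc n ] f j ≡ f i + n
  ∑-ones-except {n} f i f≡1 = begin
    ∑[ j < suc n ] f j              ≡⟨ sum-remove {i = i} f ⟩
    f i + ∑[ j < n ] f (punchIn i j) ≡⟨ cong (f i +_) (sum-cong-≗ λ j → f≡1 _ λ eq → punchInᵢ≢i i j (sym eq)) ⟩
    f i + ∑[ j < n ] 1              ≡⟨ cong (f i +_) (trans (∑-const n 1) (*-identityʳ n)) ⟩
    f i + n                         ∎

  ∑∑-indicator≡∣supp∣² : ∀ {n} (u : Word n) →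
    ∑[ i < n ] (∑[ j < n ] indicator (inSupp u i ∧ inSupp u j)) ≡ ∣supp∣ u * ∣supp∣ u
  ∑∑-indicator≡∣supp∣² {n} u = begin
    ∑[ i < n ] (∑[ j < n ] indicator (inSupp u i ∧ inSupp u j))
      ≡⟨ sum-cong-≗ (λ i → sum-cong-≗ λ j → indicator-∧ (inSupp u i) (inSupp u j)) ⟩
    ∑[ i < n ] (∑[ j < n ] (indicator (inSupp u i) * indicator (inSupp u j)))
      ≡⟨ sum-cong-≗ (λ i → *-distribˡ-sum (indicator (inSupp u i)) (λ j → indicator (inSupp u j))) ⟨
    ∑[ i < n ] (indicator (inSupp u i) * ∣supp∣ u)
      ≡⟨ *-distribʳ-sum (∣supp∣ u) (λ i → indicator (inSupp u i)) ⟨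
    ∣supp∣ u * ∣supp∣ u ∎

  ∑∑-coverCount : ∀ {n} (C : List (Word n)) →
    ∑[ i < n ] (∑[ j < n ] coverCount C i j) ≡ sum (map (λ c → ∣supp∣ c * ∣supp∣ c) C)
  ∑∑-coverCount {n} [] = trans (sum-cong-≗ {n} λ _ → ∑-zeros n) (∑-zeros n)
  ∑∑-coverCount {n} (c ∷ C) = begin
    ∑[ i < n ] (∑[ j < n ] (pair i j + coverCount C i j))
      ≡⟨ sum-cong-≗ (λ i → ∑-distrib-+ (pair i) _) ⟩
    ∑[ i < n ] (∑[ j < n ] pair i j + ∑[ j < n ] coverCount C i j)
      ≡⟨ ∑-distrib-+ (λ i → ∑[ j < n ] pair i j) _ ⟩
    ∑[ i < n ] (∑[ j < n ] pair i j) + ∑[ i < n ] (∑[ j < n ] coverCount C i j)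
      ≡⟨ cong₂ _+_ (∑∑-indicator≡∣supp∣² c) (∑∑-coverCount C) ⟩
    ∣supp∣ c * ∣supp∣ c + sum (map (λ c → ∣supp∣ c * ∣supp∣ c) C) ∎
    where
    pair : Fin n → Fin n → ℕ
    pair i j = indicator (inSupp c i ∧ inSupp c j)

  ∑-coverCount-diagonal : ∀ {n} (C : List (Word n)) →
    ∑[ i < n ] coverCount C i i ≡ sum (map ∣supp∣ C)
  ∑-coverCount-diagonal {n} [] = ∑-zeros n
  ∑-coverCount-diagonal {n} (c ∷ C) = begin
    ∑[ i < n ] (indicator (inSupp c i ∧ inSupp c i) + coverCount C i i)
      ≡⟨ ∑-distrib-+ (λ i → indicator (inSupp c i ∧ inSupp c i)) _ ⟩
    ∑[ i < n ] indicator (inSupp c i ∧ inSupp c i) + ∑[ i < n ] coverCount C i i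
      ≡⟨ cong₂ _+_ (sum-cong-≗ λ i → cong indicator (∧-idem (inSupp c i))) (∑-coverCount-diagonal C) ⟩
    ∣supp∣ c + sum (map ∣supp∣ C) ∎

  balanced⇒∑∣supp∣² : ∀ {n} (C : List (Word n)) → Balanced C →
    sum (map (λ c → ∣supp∣ c * ∣supp∣ c) C) ≡ sum (map ∣supp∣ C) + n * (n ∸ 1)
  balanced⇒∑∣supp∣² {zero} C _ = begin
    sum (map (λ c → ∣supp∣ c * ∣supp∣ c) C) ≡⟨ ∑∑-coverCount C ⟨
    0                                       ≡⟨ ∑-coverCount-diagonal C ⟩
    sum (map ∣supp∣ C)                      ≡⟨ +-identityʳ _ ⟨
    sum (map ∣supp∣ C) + 0                  ∎
  balanced⇒∑∣supp∣² {suc n} C balanced = begin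
    sum (map (λ c → ∣supp∣ c * ∣supp∣ c) C)       ≡⟨ ∑∑-coverCount C ⟨
    ∑[ i < suc n ] (∑[ j < suc n ] coverCount C i j) ≡⟨ sum-cong-≗ (λ i → ∑-ones-except _ i (balanced i)) ⟩
    ∑[ i < suc n ] (coverCount C i i + n)         ≡⟨ ∑-distrib-+ (λ i → coverCount C i i) (λ _ → n) ⟩
    ∑[ i < suc n ] coverCount C i i + ∑[ i < suc n ] n
      ≡⟨ cong₂ _+_ (∑-coverCount-diagonal C) (∑-const (suc n) n) ⟩
    sum (map ∣supp∣ C) + suc n * n                ∎

  inSupp-∷-suc : ∀ {n} a (u : Word n) i → inSupp (a ∷ u) (suc i) ≡ inSupp u i
  inSupp-∷-suc a u i with toℕ (lookup u i)
  ... | zero = refl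
  ... | suc _ = refl

  ∣supp∣-∷ : ∀ {n} a (u : Word n) → ∣supp∣ (a ∷ u) ≡ indicator (inSupp (a ∷ u) 0F) + ∣supp∣ u
  ∣supp∣-∷ a u = cong (indicator (inSupp (a ∷ u) 0F) +_) (sum-cong-≗ λ i → cong indicator (inSupp-∷-suc a u i))

  ∣supp∣≡count1+count2 : ∀ {n} (u : Word n) → ∣supp∣ u ≡ countSym 1F u + countSym 2F u
  ∣supp∣≡count1+count2 [] = refl
  ∣supp∣≡count1+count2 (0F ∷ u) = trans (∣supp∣-∷ 0F u) (∣supp∣≡count1+count2 u)
  ∣supp∣≡count1+count2 (1F ∷ u) = trans (∣supp∣-∷ 1F u) (cong suc (∣supp∣≡count1+count2 u))
  ∣supp∣≡count1+count2 (2F ∷ u) = trans (∣supp∣-∷ 2F u) (trans (cong suc (∣supp∣≡count1+count2 u)) (sym (+-suc _ _)))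

  HasType⇒∣supp∣ : ∀ {n} (u : Word n) {a b} → HasType u a b → ∣supp∣ u ≡ a + b
  HasType⇒∣supp∣ u (#1≡a , #2≡b) = trans (∣supp∣≡count1+count2 u) (cong₂ _+_ #1≡a #2≡b)

  hasType? : ∀ {n} (u : Word n) a b → Dec (HasType u a b)
  hasType? u a b = (countSym 1F u ≟ a) ×-dec (countSym 2F u ≟ b)

  square-of-two-sizes : ∀ {s} v → s ≡ suc v ⊎ s ≡ v →
    ∃ λ δ → s * s + 2 * v * δ ≡ s + suc v * v
  square-of-two-sizes v (inj₁ refl) = 0 , large v
    where
    large : ∀ v → suc v * suc v + 2 * v * 0 ≡ suc v + suc v * v
    large = solve-∀
  square-of-two-sizes v (inj₂ refl) = 1 , small v
    where
    small : ∀ v → v * v + 2 * v * 1 ≡ v + suc v * v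
    small = solve-∀

  -- b counts the codewords of the smaller size.
  ∑∣supp∣²-of-two-sizes : ∀ {n} v {C : List (Word n)} → All (λ c → ∣supp∣ c ≡ suc v ⊎ ∣supp∣ c ≡ v) C →
    ∃ λ b → sum (map (λ c → ∣supp∣ c * ∣supp∣ c) C) + 2 * v * b ≡ sum (map ∣supp∣ C) + suc v * v * length C
  ∑∣supp∣²-of-two-sizes v [] = 0 , trans (*-zeroʳ (2 * v)) (sym (*-zeroʳ (suc v * v)))
  ∑∣supp∣²-of-two-sizes v {c ∷ C} (c-size ∷ C-sizes)
    with square-of-two-sizes v c-size | ∑∣supp∣²-of-two-sizes v C-sizes
  ... | δ , c-square | b , C-squares = δ + b , (begin
    s * s + S₂ + 2 * v * (δ + b)             ≡⟨ regroupˡ s S₂ v δ b ⟩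
    (s * s + 2 * v * δ) + (S₂ + 2 * v * b)   ≡⟨ cong₂ _+_ c-square C-squares ⟩
    (s + suc v * v) + (S₁ + suc v * v * L)   ≡⟨ regroupʳ s S₁ v L ⟩
    s + S₁ + suc v * v * suc L               ∎)
    where
    s = ∣supp∣ c
    S₁ = sum (map ∣supp∣ C)
    S₂ = sum (map (λ c → ∣supp∣ c * ∣supp∣ c) C)
    L = length C
    regroupˡ : ∀ s S₂ v δ b → s * s + S₂ + 2 * v * (δ + b) ≡ (s * s + 2 * v * δ) + (S₂ + 2 * v * b)
    regroupˡ = solve-∀
    regroupʳ : ∀ s S₁ v L → (s + suc v * v) + (S₁ + suc v * v * L) ≡ s + S₁ + suc v * v * suc L
    regroupʳ = solve-∀

  balanced-two-sizes⇒count : ∀ {n} v (C : List (Word n)) → Balanced C →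
    All (λ c → ∣supp∣ c ≡ suc v ⊎ ∣supp∣ c ≡ v) C →
    ∃ λ b → n * (n ∸ 1) + 2 * v * b ≡ suc v * v * length C
  balanced-two-sizes⇒count {n} v C balanced sizes with ∑∣supp∣²-of-two-sizes v sizes
  ... | b , squares = b , +-cancelˡ-≡ S₁ _ _ (begin
    S₁ + (n * (n ∸ 1) + 2 * v * b)  ≡⟨ +-assoc S₁ _ _ ⟨
    S₁ + n * (n ∸ 1) + 2 * v * b    ≡⟨ cong (_+ 2 * v * b) (balanced⇒∑∣supp∣² C balanced) ⟨
    S₂ + 2 * v * b                  ≡⟨ squares ⟩
    S₁ + suc v * v * length C       ∎)
    where
    S₁ = sum (map ∣supp∣ C)
    S₂ = sum (map (λ c → ∣supp∣ c * ∣supp∣ c) C)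

  ∣supp∣-unless-other-type : ∀ {n} (c : Word n) y →
    ¬ (¬ HasType c (suc (suc y)) 0 × ¬ HasType c y 1) → ∣supp∣ c ≡ suc (suc y) ⊎ ∣supp∣ c ≡ suc y
  ∣supp∣-unless-other-type c y not-other with hasType? c (suc (suc y)) 0 | hasType? c y 1
  ... | yes type-1ʷ | _ = inj₁ (trans (HasType⇒∣supp∣ c type-1ʷ) (+-identityʳ _))
  ... | no _ | yes type-1ʸ2 = inj₂ (trans (HasType⇒∣supp∣ c type-1ʸ2) (+-comm y 1))
  ... | no ¬type-1ʷ | no ¬type-1ʸ2 = ⊥-elim (not-other (¬type-1ʷ , ¬type-1ʸ2))

-- Here w = y + 2 and v = w − 1 = y + 1, so the paper's (w − 1)(w − 2) is v y.
module Residues where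
  open import Data.Integer using (ℤ; +_; -[1+_]; _+_; _-_; _*_; -_; 1ℤ; _/ℕ_; _%ℕ_)
  open import Data.Integer.DivMod using (a≡a%ℕn+[a/ℕn]*n; n%ℕd<d)
  open import Data.Integer.Divisibility using (_∣_)
  open import Data.Integer.Divisibility.Signed using (∣ᵤ⇒∣; divides)
  open import Data.Integer.Properties using (+-injective; pos-+; pos-*; neg-distribˡ-*)
  open import Data.Integer.Tactic.RingSolver using (solve)
  open import Data.List using ([]; _∷_)
  import Data.Nat as ℕ
  open import Data.Nat using (ℕ; zero; suc; NonZero; _∸_; _<_; _≤_)
  open import Data.Nat.DivMod using (_%_; m<n⇒m%n≡m; [m+kn]%n≡m%n)
  import Data.Nat.Properties as ℕ
  import Data.Nat.Tactic.RingSolver as ℕ-Solver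
  open import Data.Empty using (⊥)
  open import Relation.Binary.PropositionalEquality
  open ≡-Reasoning

  residue-of-count : ∀ (n y b Q R P D : ℤ) → let v = 1ℤ + y in
    D ≡ (1ℤ + v) * v → P ≡ v * y →
    n * (n - 1ℤ) + + 2 * v * b ≡ D * (Q + n) →
    n * (n - 1ℤ - P) ≡ R + Q * D →
    R + + 2 * v * b ≡ + 2 * v * n
  residue-of-count n y b Q R P D refl refl count division =
    let v = 1ℤ + y; w = 1ℤ + v in begin
    R + + 2 * v * b                                   ≡⟨ solve (R ∷ Q ∷ y ∷ b ∷ []) ⟩
    (R + Q * (w * v)) - Q * (w * v) + + 2 * v * b
      ≡⟨ cong (λ A → A - Q * (w * v) + + 2 * v * b) division ⟨
    n * (n - 1ℤ - v * y) - Q * (w * v) + + 2 * v * b  ≡⟨ solve (n ∷ Q ∷ y ∷ b ∷ []) ⟩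
    (n * (n - 1ℤ) + + 2 * v * b) - n * (v * y) - Q * (w * v)
      ≡⟨ cong (λ t → t - n * (v * y) - Q * (w * v)) count ⟩
    w * v * (Q + n) - n * (v * y) - Q * (w * v)       ≡⟨ solve (n ∷ Q ∷ y ∷ []) ⟩
    + 2 * v * n                                       ∎

  residue-by-divisibility : ∀ (n P r q Q R D : ℤ) →
    n * (n - 1ℤ - P) ≡ R + Q * D →
    n * (n - 1ℤ) - n * P - r ≡ q * D →
    R ≡ r + (q - Q) * D
  residue-by-divisibility n P r q Q R D division divisible = begin
    R                                       ≡⟨ solve (R ∷ Q ∷ D ∷ []) ⟩
    (R + Q * D) - Q * D                     ≡⟨ cong (_- Q * D) division ⟨
    n * (n - 1ℤ - P) - Q * D                ≡⟨ solve (n ∷ P ∷ r ∷ Q ∷ D ∷ []) ⟩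
    (n * (n - 1ℤ) - n * P - r) + r - Q * D  ≡⟨ cong (λ t → t + r - Q * D) divisible ⟩
    q * D + r - Q * D                       ≡⟨ solve (r ∷ q ∷ Q ∷ D ∷ []) ⟩
    r + (q - Q) * D                         ∎

  remainder-unique-ℕ : ∀ {d r s k} .{{_ : NonZero d}} → r < d → s < d → r ≡ s ℕ.+ k ℕ.* d → r ≡ s
  remainder-unique-ℕ {d} {r} {s} {k} r<d s<d r≡s+kd = begin
    r                   ≡⟨ m<n⇒m%n≡m r<d ⟨
    r % d               ≡⟨ cong (_% d) r≡s+kd ⟩
    (s ℕ.+ k ℕ.* d) % d ≡⟨ [m+kn]%n≡m%n s k d ⟩
    s % d               ≡⟨ m<n⇒m%n≡m s<d ⟩
    s                   ∎

  pos-linear-injective : ∀ {r s k d} → + r ≡ + s + + k * + d → r ≡ s ℕ.+ k ℕ.* d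
  pos-linear-injective {r} {s} {k} {d} r≡s+kd = +-injective (begin
    + r                 ≡⟨ r≡s+kd ⟩
    + s + + k * + d     ≡⟨ cong (λ t → + s + t) (pos-* k d) ⟨
    + s + + (k ℕ.* d)   ≡⟨ pos-+ s (k ℕ.* d) ⟨
    + (s ℕ.+ k ℕ.* d)   ∎)

  remainder-unique : ∀ {d r s} .{{_ : NonZero d}} → r < d → s < d → ∀ q → + r ≡ + s + q * + d → r ≡ s
  remainder-unique {d} {r} {s} r<d s<d (+ k) r≡s+kd =
    remainder-unique-ℕ {k = k} r<d s<d (pos-linear-injective {r} {s} {k} {d} r≡s+kd)
  remainder-unique {d} {r} {s} r<d s<d q@(-[1+ k ]) r≡s+qd =
    sym (remainder-unique-ℕ {k = suc k} s<d r<d (pos-linear-injective {s} {r} {suc k} {d} (begin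
      + s                       ≡⟨ x≡x+y-y (+ s) (q * + d) ⟩
      + s + q * + d - q * + d   ≡⟨ cong (_- q * + d) r≡s+qd ⟨
      + r - q * + d             ≡⟨ cong (λ t → + r + t) (neg-distribˡ-* q (+ d)) ⟩
      + r + - q * + d           ∎)))
    where
    x≡x+y-y : ∀ x y → x ≡ x + y - y
    x≡x+y-y x y = solve (x ∷ y ∷ [])

  pos-n*[n∸1] : ∀ n → + (n ℕ.* (n ∸ 1)) ≡ + n * (+ n - 1ℤ)
  pos-n*[n∸1] zero = refl
  pos-n*[n∸1] (suc m) = pos-* (suc m) m

  pos-*-* : ∀ a b c → + (a ℕ.* b ℕ.* c) ≡ + a * + b * + c
  pos-*-* a b c = trans (pos-* (a ℕ.* b) c) (cong (_* + c) (pos-* a b))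

  B-numerator : ℕ → ℕ → ℤ
  B-numerator w n = + n * (+ n - 1ℤ - + ((w ∸ 1) ℕ.* (w ∸ 2)))

  B-denominator : ℕ → ℕ
  B-denominator w = w ℕ.* (w ∸ 1)

  remainder-of-count : ∀ n y b L → let w = suc (suc y); v = suc y in
    n ℕ.* (n ∸ 1) ℕ.+ 2 ℕ.* v ℕ.* b ≡ w ℕ.* v ℕ.* L →
    + L ≡ B w n + + n →
    B-numerator w n %ℕ B-denominator w ℕ.+ 2 ℕ.* v ℕ.* b ≡ 2 ℕ.* v ℕ.* n
  remainder-of-count n y b L count len = +-injective (begin
    + (R ℕ.+ 2 ℕ.* v ℕ.* b)     ≡⟨ pos-+ R (2 ℕ.* v ℕ.* b) ⟩
    + R + + (2 ℕ.* v ℕ.* b)     ≡⟨ cong (λ t → + R + t) (pos-*-* 2 v b) ⟩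
    + R + + 2 * + v * + b       ≡⟨ residue-of-count (+ n) (+ y) (+ b) Q (+ R) (+ (v ℕ.* y)) (+ D)
                                     (pos-* w v) (pos-* v y) count-ℤ (a≡a%ℕn+[a/ℕn]*n A D) ⟩
    + 2 * + v * + n             ≡⟨ pos-*-* 2 v n ⟨
    + (2 ℕ.* v ℕ.* n)           ∎)
    where
    v = suc y
    w = suc v
    D = B-denominator w
    A = B-numerator w n
    Q = A /ℕ D
    R = A %ℕ D
    count-ℤ : + n * (+ n - 1ℤ) + + 2 * + v * + b ≡ + D * (Q + + n)
    count-ℤ = begin
      + n * (+ n - 1ℤ) + + 2 * + v * + b  ≡⟨ cong₂ _+_ (pos-n*[n∸1] n) (pos-*-* 2 v b) ⟨
      + (n ℕ.* (n ∸ 1)) + + (2 ℕ.* v ℕ.* b) ≡⟨ pos-+ (n ℕ.* (n ∸ 1)) (2 ℕ.* v ℕ.* b) ⟨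
      + (n ℕ.* (n ∸ 1) ℕ.+ 2 ℕ.* v ℕ.* b) ≡⟨ cong +_ count ⟩
      + (D ℕ.* L)                        ≡⟨ pos-* D L ⟩
      + D * + L                          ≡⟨ cong (+ D *_) len ⟩
      + D * (Q + + n)                    ∎

  remainder-of-divisibility : ∀ n y k → let w = suc (suc y); v = suc y in
    2 ℕ.* k ℕ.+ 3 ≤ w →
    + B-denominator w ∣ (+ n * (+ n - + 1) - + n * + (v ℕ.* y) - + ((2 ℕ.* k ℕ.+ 1) ℕ.* v)) →
    B-numerator w n %ℕ B-denominator w ≡ (2 ℕ.* k ℕ.+ 1) ℕ.* v
  remainder-of-divisibility n y k 2k+3≤w divisible with ∣ᵤ⇒∣ divisible
  ... | divides q A-r≡qD = remainder-unique (n%ℕd<d A D) r<D (q - Q)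
          (residue-by-divisibility (+ n) (+ (v ℕ.* y)) (+ r) q Q (+ (A %ℕ D)) (+ D)
            (a≡a%ℕn+[a/ℕn]*n A D) A-r≡qD)
    where
    v = suc y
    w = suc v
    D = B-denominator w
    A = B-numerator w n
    Q = A /ℕ D
    r = (2 ℕ.* k ℕ.+ 1) ℕ.* v
    r<D : r < D
    r<D = ℕ.*-monoˡ-< v (ℕ.<-≤-trans (ℕ.+-monoʳ-< (2 ℕ.* k) (ℕ.s≤s (ℕ.s≤s ℕ.z≤n))) 2k+3≤w)

  count-contradiction : ∀ n y k b L → let w = suc (suc y); v = suc y in
    2 ℕ.* k ℕ.+ 3 ≤ w →
    n ℕ.* (n ∸ 1) ℕ.+ 2 ℕ.* v ℕ.* b ≡ w ℕ.* v ℕ.* L →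
    + L ≡ B w n + + n →
    + B-denominator w ∣ (+ n * (+ n - + 1) - + n * + (v ℕ.* y) - + ((2 ℕ.* k ℕ.+ 1) ℕ.* v)) →
    ⊥
  count-contradiction n y k b L 2k+3≤w count len divisible =
    ℕ.even≢odd n (k ℕ.+ b) (ℕ.*-cancelʳ-≡ (2 ℕ.* n) (suc (2 ℕ.* (k ℕ.+ b))) (suc y) (begin
      2 ℕ.* n ℕ.* suc y                               ≡⟨ ℕ-Solver.solve (n ∷ y ∷ []) ⟩
      2 ℕ.* suc y ℕ.* n                               ≡⟨ remainder-of-count n y b L count len ⟨
      B-numerator w n %ℕ B-denominator w ℕ.+ 2 ℕ.* suc y ℕ.* b
        ≡⟨ cong (ℕ._+ 2 ℕ.* suc y ℕ.* b) (remainder-of-divisibility n y k 2k+3≤w divisible) ⟩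
      (2 ℕ.* k ℕ.+ 1) ℕ.* suc y ℕ.+ 2 ℕ.* suc y ℕ.* b ≡⟨ ℕ-Solver.solve (k ∷ y ∷ b ∷ []) ⟩
      suc (2 ℕ.* (k ℕ.+ b)) ℕ.* suc y                 ∎))
    where
    w = suc (suc y)

open import Data.Nat using (ℕ; suc; s≤s; _+_; _*_; _∸_; _≤_)
open import Data.Nat.Divisibility using (_∣_)
open import Data.Integer using (+_; _-_)
import Data.Integer as ℤ
import Data.Integer.Divisibility as ℤD
open import Data.List using (List; length)
open import Data.List.Membership.Propositional using (_∈_; find)
import Data.List.Relation.Unary.All as All
open import Data.List.Relation.Unary.All.Properties using (¬Any⇒All¬)
open import Data.List.Relation.Unary.Any using (any?)
open import Data.Product using (∃; _×_; _,_)
open import Data.Empty using (⊥; ⊥-elim)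
open import Relation.Binary.PropositionalEquality using (_≡_)
open import Relation.Nullary.Decidable using (yes; no; ¬?; _×-dec_)

open Supports using (hasType?; ∣supp∣-unless-other-type; balanced-two-sizes⇒count)
open Residues using (count-contradiction)

lemma4 : (w n k : ℕ) → 3 ≤ w → 1 ≤ n → (w ∸ 1) ∣ (n ∸ 1)
    → 2 * k + 3 ≤ w
    → (+ (w * (w ∸ 1))) ℤD.∣ ((+ n) ℤ.* ((+ n) - + 1) - (+ n) ℤ.* + ((w ∸ 1) * (w ∸ 2)) - + ((2 * k + 1) * (w ∸ 1)))
    → (C : List (Word n)) → IsCode n (2 * w ∸ 2) w C → Balanced C
    → + (length C) ≡ B w n ℤ.+ + n
    → ∃ λ c → c ∈ C × (HasType c w 0 → ⊥) × (HasType c (w ∸ 2) 1 → ⊥)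
lemma4 w@(suc (suc y)) n k (s≤s (s≤s _)) _ _ 2k+3≤w divisible C _ balanced len
  with any? (λ c → ¬? (hasType? c w 0) ×-dec ¬? (hasType? c y 1)) C
... | yes other-type = find other-type
... | no ¬other-type
  with balanced-two-sizes⇒count (suc y) C balanced
         (All.map (λ {c} → ∣supp∣-unless-other-type c y) (¬Any⇒All¬ C ¬other-type))
... | b , count = ⊥-elim (count-contradiction n y k b (length C) 2k+3≤w count len divisible)
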